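{- Let $n\in\omega$, $\alpha\in 2^\omega$ such that $(\alpha)_i=s_{t_n(i)}10^\infty$ for each $i<n$, and $p>\langle n,0\rangle$ such that $\alpha|p$ is placed. Then $(p-1)_0\geq n$.
   Context: $\langle n,p\rangle:=(\sum_{k\leq n+p}k)+p$, a bijection $\omega^2\to\omega$ with inverse $q\mapsto((q)_0,(q)_1)$; for $u\in 2^{\leq\omega}$, $(u)_n(p):=u(\langle n,p\rangle)$ when $\langle n,p\rangle<|u|$. $t_n:=\psi(n)0^{n-|\psi(n)|}$ where $\psi:=(i\circ I)^{ -1}$, $I(\emptyset)=1$, $I(s)=\prod_{j<|s|}p_j^{s(j)+1}$ ($p_j$ the $j$-th prime), $i$ the increasing bijection $I[\omega^{<\omega}]\to\omega$. $s_n:=\phi(n)0^{n-|\phi(n)|}$ where $\phi$ is the natural enumeration of $2^{<\omega}$ by increasing length. For $u\neq\emptyset$, $u^m:=u|(|u|-1)$; $u\in 2^{<\omega}$ is placed if $u\neq\emptyset$, $(u)_i\subseteq s_{t_{(|u^m|)_0}(i)}10^\infty$ for all $i<(|u^m|)_0$, and $u(|u^m|)=1$ if $(|u^m|)_1>0$. -}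

module Defs where

open import Data.Nat using (ℕ; zero; suc; _+_; _*_; _∸_; _^_; _≤_; _<_; _≟_; _<?_)
open import Data.Nat.Divisibility using (_∣?_)
open import Data.Nat.Primality using (prime?)
open import Data.Nat using (_!)
open import Data.Bool using (Bool; true; false; if_then_else_)
open import Data.List using (List; []; _∷_; length; reverse; _++_; replicate; tabulate)
open import Data.Product using (_×_; _,_; proj₁; proj₂)
open import Relation.Nullary using (yes; no; does)
open import Relation.Binary.PropositionalEquality using (_≡_)

-- total list lookup with a default value (only ever used at indices
-- below the length of the list, where it is the ordinary lookup)
at : {A : Set} → A → List A → ℕ → A
at d []       _       = d
at d (x ∷ xs) zero    = x
at d (x ∷ xs) (suc k) = at d xs k

-- finite binary sequences: List Bool, with false = 0, true = 1
-- w 1 0^∞  as an element of 2^ω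
ext10 : List Bool → ℕ → Bool
ext10 []      zero    = true
ext10 []      (suc k) = false
ext10 (b ∷ w) zero    = b
ext10 (b ∷ w) (suc k) = ext10 w k

restrict : (ℕ → Bool) → ℕ → List Bool
restrict α p = tabulate {n = p} (λ i → α (Data.Fin.toℕ i))
  where import Data.Fin

tri : ℕ → ℕ
tri zero    = zero
tri (suc k) = suc k + tri k

pair : ℕ → ℕ → ℕ
pair n p = tri (n + p) + p

-- inverse q ↦ ((q)_0 , (q)_1): enumerates the pairs in the order of
-- ⟨_,_⟩ : after ⟨n+1,p⟩ comes ⟨n,p+1⟩, after ⟨0,p⟩ comes ⟨p+1,0⟩
unpair : ℕ → ℕ × ℕ
unpair zero = (0 , 0)
unpair (suc q) with unpair q
... | (suc n , p) = (n , suc p)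
... | (zero  , p) = (suc p , 0)

proj0 : ℕ → ℕ
proj0 q = proj₁ (unpair q)

proj1 : ℕ → ℕ
proj1 q = proj₂ (unpair q)

-- "(u)_i ⊆ x": for every p with ⟨i,p⟩ < |u|, (u)_i(p) = u(⟨i,p⟩) = x(p)
SubPrefix : List Bool → ℕ → (ℕ → Bool) → Set
SubPrefix u i x = ∀ p → pair i p < length u → at false u (pair i p) ≡ x p

-- φ : natural enumeration of 2^{<ω} by increasing length
-- (lexicographically, 0 < 1, within each length):
-- ∅, 0, 1, 00, 01, 10, 11, 000, ...

-- binary increment on reversed strings, overflowing 1^k to 0^{k+1}
incR : List Bool → List Bool
incR []          = false ∷ []
incR (false ∷ r) = true ∷ r
incR (true ∷ r)  = false ∷ incR r

φR : ℕ → List Bool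
φR zero    = []
φR (suc n) = incR (φR n)

φ : ℕ → List Bool
φ n = reverse (φR n)

s : ℕ → List Bool
s n = φ n ++ replicate (n ∸ length (φ n)) false

-- least prime in [a, a + fuel), or a + fuel if there is none
searchPrime : ℕ → ℕ → ℕ
searchPrime a zero       = a
searchPrime a (suc fuel) with prime? a
... | yes _ = a
... | no  _ = searchPrime (suc a) fuel

-- least prime > p; by Euclid there is one in (p, p! + 1]
nextPrime : ℕ → ℕ
nextPrime p = searchPrime (suc p) (p !)

prm : ℕ → ℕ
prm zero    = 2
prm (suc j) = nextPrime (prm j)

Iaux : ℕ → List ℕ → ℕ
Iaux j []       = 1
Iaux j (x ∷ xs) = prm j ^ suc x * Iaux (suc j) xs

I : List ℕ → ℕ
I = Iaux 0

-- largest e ≤ bound with q^e ∣ c (for c > 0, q ≥ 2 and bound ≥ c this is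
-- the exponent of q in c)
maxExp : ℕ → ℕ → ℕ → ℕ
maxExp q c zero        = 0
maxExp q c (suc e) with (q ^ suc e) ∣? c
... | yes _ = suc e
... | no  _ = maxExp q c e

-- decode c: the sequence (e_j - 1)_{j<k}, where e_j is the exponent of
-- p_j in c and k is least with e_k = 0.  c ∈ I[ω^{<ω}] iff I(decode c) = c.
decodeAux : ℕ → ℕ → ℕ → List ℕ
decodeAux c j zero       = []
decodeAux c j (suc fuel) with maxExp (prm j) c c
... | zero  = []
... | suc e = e ∷ decodeAux c (suc j) fuel

decode : ℕ → List ℕ
decode c = decodeAux c 0 c

isCode : ℕ → Bool
isCode c = does (I (decode c) ≟ c)

searchCode : ℕ → ℕ → ℕ
searchCode a zero       = a
searchCode a (suc fuel) = if isCode a then a else searchCode (suc a) fuel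

-- code m := the m-th element (in increasing order) of I[ω^{<ω}],
-- i.e. i⁻¹(m).  The least code is 1 = I(∅); the next code after c is ≤ 2c.
code : ℕ → ℕ
code zero    = 1
code (suc m) = searchCode (suc (code m)) (suc (code m))

ψ : ℕ → List ℕ
ψ m = decode (code m)

t : ℕ → List ℕ
t n = ψ n ++ replicate (n ∸ length (ψ n)) 0

-- placed sequences.  For u ≠ ∅, |u^m| = |u| - 1.

Placed : List Bool → Set
Placed []          = Data.Empty.⊥
  where import Data.Empty
Placed u@(_ ∷ _)   =
  (∀ i → i < proj0 q → SubPrefix u i (ext10 (s (at 0 (t (proj0 q)) i))))
  × (0 < proj1 q → at false u q ≡ true)
  where q = length u ∸ 1

module Submission where

-- Write q = p - 1 = ⟨m, r⟩ and suppose m < n.  Since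
-- ⟨n,0⟩ ≤ q, the pair ⟨m,r⟩ lies on a diagonal at least n, so n ≤ m + r.
-- On the other hand every entry of t_n is small: m + t_n(m) < n, because
-- ψ(n) has I-code i⁻¹(n) ≤ 2^n while I(ψ(n)) ≥ 2^(m + 1 + ψ(n)(m)).
-- Hence e := t_n(m) < r, so (q)_1 = r > 0 and placedness forces α(q) = 1;
-- but α(q) = (α)_m(r) = (s_e 1 0^∞)(r) = 0 because |s_e| = e < r.

open import Defs
open import Data.Nat using (ℕ; _∸_; _<_; _≥_)
open import Data.Bool using (Bool)
open import Relation.Binary.PropositionalEquality using (_≡_)

open import Data.Nat using (zero; suc; _+_; _*_; _^_; _≤_; z≤n; s≤s; _≤?_; _<?_; _≟_; _!)
open import Data.Nat.Properties
open import Data.Nat.Divisibility using (_∣_; _∣?_; 1∣_; ∣⇒≤; ∣1⇒≡1; ∣n⇒∣m*n; ∣-trans; ∣-refl)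
open import Data.Nat.Primality using (prime?; euclidsLemma)
open import Data.Bool using (true; false; T)
open import Data.Unit using (tt)
open import Data.List using ([]; _∷_; length; _++_; replicate)
open import Data.List.Properties using (length-tabulate; length-reverse; length-replicate; length-++)
open import Data.Product using (_×_; _,_; proj₁; proj₂; ∃)
open import Data.Sum using (inj₁; inj₂)
open import Data.Empty using (⊥-elim)
import Data.Fin as Fin
open import Relation.Nullary using (yes; no; ¬_; contradiction)
open import Relation.Nullary.Decidable using (from-yes; dec-true)
open import Relation.Binary.PropositionalEquality using (refl; sym; trans; cong; subst; module ≡-Reasoning)

pair-unpair : ∀ q → pair (proj0 q) (proj1 q) ≡ q
pair-unpair zero = refl
pair-unpair (suc q) with unpair q | pair-unpair q
... | (suc m , r) | eq = begin
  tri (m + suc r) + suc r   ≡⟨ cong (λ d → tri d + suc r) (+-suc m r) ⟩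
  tri (suc m + r) + suc r   ≡⟨ +-suc _ r ⟩
  suc (tri (suc m + r) + r) ≡⟨ cong suc eq ⟩
  suc q                     ∎
  where open ≡-Reasoning
... | (zero , r) | eq = begin
  tri (suc r + 0) + 0 ≡⟨ +-identityʳ _ ⟩
  tri (suc r + 0)     ≡⟨ cong tri (+-identityʳ (suc r)) ⟩
  suc r + tri r       ≡⟨ cong suc (+-comm r (tri r)) ⟩
  suc (tri r + r)     ≡⟨ cong suc eq ⟩
  suc q               ∎
  where open ≡-Reasoning

tri-mono : ∀ {a b} → a ≤ b → tri a ≤ tri b
tri-mono {zero}  _          = z≤n
tri-mono {suc a} (s≤s a≤b) = +-mono-≤ (s≤s a≤b) (tri-mono a≤b)

-- Every pair on diagonal d = m + r precedes the first pair ⟨d+1, 0⟩ of the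
-- next diagonal; hence ⟨n,0⟩ ≤ ⟨m,r⟩ forces n ≤ m + r.
pair-diagonal : ∀ n m r → pair n 0 ≤ pair m r → n ≤ m + r
pair-diagonal n m r le with n ≤? m + r
... | yes n≤d = n≤d
... | no  n≰d = ⊥-elim (<⇒≱ below-next le)
  where
  d = m + r
  below-next : pair m r < pair n 0
  below-next = begin-strict
    tri d + r     ≤⟨ +-monoʳ-≤ (tri d) (m≤n+m r m) ⟩
    tri d + d     <⟨ ≤-reflexive (cong suc (+-comm (tri d) d)) ⟩
    tri (suc d)   ≤⟨ tri-mono (≰⇒> n≰d) ⟩
    tri n         ≡⟨ cong tri (sym (+-identityʳ n)) ⟩
    tri (n + 0)   ≡⟨ sym (+-identityʳ _) ⟩
    pair n 0      ∎
    where open ≤-Reasoning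

ext10-beyond : ∀ w r → length w < r → ext10 w r ≡ false
ext10-beyond []      (suc r) _         = refl
ext10-beyond (b ∷ w) (suc r) (s≤s lt) = ext10-beyond w r lt

incR-length : ∀ r → length (incR r) ≤ suc (length r)
incR-length []          = ≤-refl
incR-length (false ∷ r) = n≤1+n _
incR-length (true ∷ r)  = s≤s (incR-length r)

φ-length : ∀ n → length (φ n) ≤ n
φ-length n = subst (_≤ n) (sym (length-reverse (φR n))) (φR-length n)
  where
  φR-length : ∀ n → length (φR n) ≤ n
  φR-length zero    = z≤n
  φR-length (suc n) = ≤-trans (incR-length (φR n)) (s≤s (φR-length n))

s-length : ∀ e → length (s e) ≡ e
s-length e = begin
  length (φ e ++ replicate (e ∸ length (φ e)) false)       ≡⟨ length-++ (φ e) ⟩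
  length (φ e) + length (replicate (e ∸ length (φ e)) false) ≡⟨ cong (length (φ e) +_) (length-replicate (e ∸ length (φ e))) ⟩
  length (φ e) + (e ∸ length (φ e))                          ≡⟨ m+[n∸m]≡n (φ-length e) ⟩
  e                                                          ∎
  where open ≡-Reasoning

at-++ˡ : ∀ {A : Set} (d : A) xs ys m → m < length xs → at d (xs ++ ys) m ≡ at d xs m
at-++ˡ d (x ∷ xs) ys zero    _        = refl
at-++ˡ d (x ∷ xs) ys (suc m) (s≤s lt) = at-++ˡ d xs ys m lt

at-++ʳ : ∀ {A : Set} (d : A) xs ys m → length xs ≤ m → at d (xs ++ ys) m ≡ at d ys (m ∸ length xs)
at-++ʳ d []       ys m       _        = refl
at-++ʳ d (x ∷ xs) ys (suc m) (s≤s le) = at-++ʳ d xs ys m le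

at-replicate : ∀ {A : Set} (d : A) k i → at d (replicate k d) i ≡ d
at-replicate d zero    i       = refl
at-replicate d (suc k) zero    = refl
at-replicate d (suc k) (suc i) = at-replicate d k i

^-reflects-≤ : ∀ q a b → 1 < q → q ^ a ≤ q ^ b → a ≤ b
^-reflects-≤ q a b 1<q le with a ≤? b
... | yes a≤b = a≤b
... | no  a≰b = ⊥-elim (<⇒≱ (^-monoʳ-< q 1<q (≰⇒> a≰b)) le)

^-∣-≤ : ∀ q {a b} → a ≤ b → q ^ a ∣ q ^ b
^-∣-≤ q {a} {b} a≤b = subst (λ e → q ^ a ∣ q ^ e) (m∸n+n≡m a≤b) (grow (b ∸ a))
  where
  grow : ∀ d → q ^ a ∣ q ^ (d + a)
  grow zero    = ∣-refl
  grow (suc d) = ∣n⇒∣m*n q (grow d)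

-- n < 2^n: the exponent search and the decoding of 2^K have enough room.
n<2^n : ∀ n → n < 2 ^ n
n<2^n zero    = s≤s z≤n
n<2^n (suc n) = +-mono-≤ (m^n>0 2 n) (≤-trans (n<2^n n) (m≤m+n (2 ^ n) 0))

2^suc∤2^ : ∀ K → ¬ (2 ^ suc K ∣ 2 ^ K)
2^suc∤2^ K d = <⇒≱ (^-monoʳ-< 2 (s≤s (s≤s z≤n)) (n<1+n K)) (∣⇒≤ {{m^n≢0 2 K}} d)

-- 3 is prime and does not divide 2, hence no power of 2.
3∤2^ : ∀ K → ¬ (3 ∣ 2 ^ K)
3∤2^ zero    d with ∣1⇒≡1 d
... | ()
3∤2^ (suc K) d with euclidsLemma 2 (2 ^ K) (from-yes (prime? 3)) d
... | inj₁ 3∣2 = <⇒≱ (s≤s (s≤s (s≤s z≤n))) (∣⇒≤ 3∣2)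
... | inj₂ 3∣K = 3∤2^ K 3∣K

power-of-two-between : ∀ c → 1 ≤ c → ∃ λ k → c < 2 ^ k × 2 ^ k ≤ 2 * c
power-of-two-between (suc zero)    _ = 1 , ≤-refl , ≤-refl
power-of-two-between (suc (suc c)) _ with power-of-two-between (suc c) (s≤s z≤n)
... | k , lt , le with suc (suc c) <? 2 ^ k
...   | yes lt′ = k , lt′ , ≤-trans le (*-monoʳ-≤ 2 (n≤1+n (suc c)))
...   | no  nlt = suc k , subst (λ x → suc (suc c) < 2 * x) (sym 2^k≡) (m<m+n _ (s≤s z≤n))
                        , ≤-reflexive (cong (2 *_) 2^k≡)
  where
  2^k≡ : 2 ^ k ≡ suc (suc c)
  2^k≡ = ≤-antisym (≮⇒≥ nlt) lt

maxExp-exact : ∀ q c b K → K ≤ b → q ^ K ∣ c → ¬ (q ^ suc K ∣ c) → maxExp q c b ≡ K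
maxExp-exact q c zero    zero z≤n _ _ = refl
maxExp-exact q c (suc b) K K≤b qK∣c ¬qK+1∣c with q ^ suc b ∣? c
... | yes qb∣c = ≤-antisym (≮⇒≥ λ K<b → ¬qK+1∣c (∣-trans (^-∣-≤ q K<b) qb∣c)) K≤b
... | no ¬qb∣c with m≤n⇒m<n∨m≡n K≤b
...   | inj₁ (s≤s K≤b′) = maxExp-exact q c b K K≤b′ qK∣c ¬qK+1∣c
...   | inj₂ refl       = ⊥-elim (¬qb∣c qK∣c)

decodeAux-step : ∀ c j f e → maxExp (prm j) c c ≡ suc e
  → decodeAux c j (suc f) ≡ e ∷ decodeAux c (suc j) f
decodeAux-step c j f e eq rewrite eq = refl

decodeAux-stop : ∀ c j f → maxExp (prm j) c c ≡ 0 → decodeAux c j (suc f) ≡ []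
decodeAux-stop c j f eq rewrite eq = refl

decode-2^suc : ∀ j → decode (2 ^ suc j) ≡ j ∷ []
decode-2^suc j = with-fuel c (≤-trans (s≤s (s≤s z≤n)) (n<2^n (suc j)))
  where
  c = 2 ^ suc j
  exp-2 : maxExp 2 c c ≡ suc j
  exp-2 = maxExp-exact 2 c c (suc j) (<⇒≤ (n<2^n (suc j))) ∣-refl (2^suc∤2^ (suc j))
  exp-3 : maxExp 3 c c ≡ 0
  exp-3 = maxExp-exact 3 c c 0 z≤n (1∣ c) (3∤2^ (suc j))
  with-fuel : ∀ f → 2 ≤ f → decodeAux c 0 f ≡ j ∷ []
  with-fuel (suc (suc f)) _ =
    trans (decodeAux-step c 0 (suc f) j exp-2) (cong (j ∷_) (decodeAux-stop c 1 f exp-3))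
  with-fuel (suc zero) (s≤s ())

isCode-sound : ∀ c → isCode c ≡ true → I (decode c) ≡ c
isCode-sound c h = ≡ᵇ⇒≡ (I (decode c)) c (subst T (sym h) tt)

2^-isCode : ∀ k → isCode (2 ^ k) ≡ true
2^-isCode zero    = refl
2^-isCode (suc j) = dec-true (I (decode (2 ^ suc j)) ≟ 2 ^ suc j)
  (trans (cong I (decode-2^suc j)) (*-identityʳ (2 ^ suc j)))

searchPrime-≥ : ∀ a f → a ≤ searchPrime a f
searchPrime-≥ a zero    = ≤-refl
searchPrime-≥ a (suc f) with prime? a
... | yes _ = ≤-refl
... | no  _ = ≤-trans (n≤1+n a) (searchPrime-≥ (suc a) f)

prm≥2 : ∀ j → 2 ≤ prm j
prm≥2 zero    = ≤-refl
prm≥2 (suc j) = ≤-trans (n≤1+n 2) (≤-trans (s≤s (prm≥2 j)) (searchPrime-≥ (suc (prm j)) (prm j !)))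

prm^≥2^ : ∀ j e → 2 ^ e ≤ prm j ^ e
prm^≥2^ j e = ^-monoˡ-≤ e (prm≥2 j)

Iaux-pos : ∀ j d → 1 ≤ Iaux j d
Iaux-pos j []       = ≤-refl
Iaux-pos j (x ∷ xs) = *-mono-≤ (≤-trans (m^n>0 2 (suc x)) (prm^≥2^ j (suc x))) (Iaux-pos (suc j) xs)

-- Each of the first m factors of I(d) is at least 2 and the m-th is at least
-- 2^(d(m)+1), so I(d) ≥ 2^(m + d(m) + 1).
Iaux-≥ : ∀ j d m → m < length d → 2 ^ suc (m + at 0 d m) ≤ Iaux j d
Iaux-≥ j (x ∷ xs) zero    _ = begin
  2 ^ suc x                          ≡⟨ *-identityʳ (2 ^ suc x) ⟨
  2 ^ suc x * 1                      ≤⟨ *-mono-≤ (prm^≥2^ j (suc x)) (Iaux-pos (suc j) xs) ⟩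
  prm j ^ suc x * Iaux (suc j) xs    ∎
  where open ≤-Reasoning
Iaux-≥ j (x ∷ xs) (suc m) (s≤s lt) =
  *-mono-≤ factor≥2 (Iaux-≥ (suc j) xs m lt)
  where
  factor≥2 : 2 ≤ prm j ^ suc x
  factor≥2 = ≤-trans (*-monoʳ-≤ 2 (m^n>0 2 x)) (prm^≥2^ j (suc x))

searchCode-finds : ∀ a f y → a ≤ y → y < a + f → isCode y ≡ true
  → isCode (searchCode a f) ≡ true × searchCode a f ≤ y
searchCode-finds a zero    y a≤y y<a _ = ⊥-elim (<⇒≱ (subst (y <_) (+-identityʳ a) y<a) a≤y)
searchCode-finds a (suc f) y a≤y y<a+f cy with isCode a in eq
... | true  = eq , a≤y
... | false with m≤n⇒m<n∨m≡n a≤y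
...   | inj₁ a<y  = searchCode-finds (suc a) f y a<y (subst (y <_) (+-suc a f) y<a+f) cy
...   | inj₂ refl with trans (sym eq) cy
...     | ()

code-pos : ∀ c → isCode c ≡ true → 1 ≤ c
code-pos c isc = subst (1 ≤_) (isCode-sound c isc) (Iaux-pos 0 (decode c))

-- The next code after a code c is found by searching (c, 2c], which
-- contains a power of two; so it is at most 2c.
next-code : ∀ c → isCode c ≡ true
  → isCode (searchCode (suc c) (suc c)) ≡ true × searchCode (suc c) (suc c) ≤ 2 * c
next-code c isc with power-of-two-between c (code-pos c isc)
... | k , c<2^k , 2^k≤2c with searchCode-finds (suc c) (suc c) (2 ^ k) c<2^k 2^k-in-range (2^-isCode k)
  where
  2^k-in-range : 2 ^ k < suc c + suc c
  2^k-in-range = s≤s (≤-trans 2^k≤2c (+-monoʳ-≤ c (≤-trans (≤-reflexive (+-identityʳ c)) (n≤1+n c))))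
...   | found , found≤2^k = found , ≤-trans found≤2^k 2^k≤2c

code-bound : ∀ n → isCode (code n) ≡ true × code n ≤ 2 ^ n
code-bound zero    = refl , ≤-refl
code-bound (suc n) with code-bound n
... | isc , c≤2^n with next-code (code n) isc
...   | found , found≤2c = found , ≤-trans found≤2c (*-monoʳ-≤ 2 c≤2^n)

t-bound : ∀ n m → m < n → m + at 0 (t n) m < n
t-bound n m m<n with m <? length (ψ n)
... | yes m<len = subst (λ e → m + e < n) (sym (at-++ˡ 0 (ψ n) _ m m<len))
    (^-reflects-≤ 2 (suc (m + at 0 (ψ n) m)) n (s≤s (s≤s z≤n)) (begin
      2 ^ suc (m + at 0 (ψ n) m) ≤⟨ Iaux-≥ 0 (ψ n) m m<len ⟩
      I (ψ n)                    ≡⟨ isCode-sound (code n) (proj₁ (code-bound n)) ⟩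
      code n                     ≤⟨ proj₂ (code-bound n) ⟩
      2 ^ n                      ∎))
  where open ≤-Reasoning
... | no  m≮len = subst (λ e → m + e < n) (sym padded) (subst (_< n) (sym (+-identityʳ m)) m<n)
  where
  padded : at 0 (t n) m ≡ 0
  padded = trans (at-++ʳ 0 (ψ n) _ m (≮⇒≥ m≮len)) (at-replicate 0 (n ∸ length (ψ n)) (m ∸ length (ψ n)))

at-restrict : ∀ α p q → q < p → at false (restrict α p) q ≡ α q
at-restrict α (suc p) zero    _        = refl
at-restrict α (suc p) (suc q) (s≤s lt) = at-restrict (λ k → α (suc k)) p q lt

placed-last : ∀ α q → Placed (restrict α (suc q)) → 0 < proj1 q → α q ≡ true
placed-last α q (_ , last) r>0 = trans (sym (at-restrict α (suc q) q ≤-refl))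
  (subst (λ x → 0 < proj1 x → at false (restrict α (suc q)) x ≡ true) len last r>0)
  where
  len : length (restrict α (suc q)) ∸ 1 ≡ q
  len = cong (_∸ 1) (length-tabulate {n = suc q} (λ i → α (Fin.toℕ i)))

lemma4p8 : (n : ℕ) (α : ℕ → Bool)
    → (∀ i → i < n → ∀ k → α (pair i k) ≡ ext10 (s (at 0 (t n) i)) k)
    → (p : ℕ) → pair n 0 < p → Placed (restrict α p)
    → proj0 (p ∸ 1) ≥ n
lemma4p8 n α hα (suc q) (s≤s ⟨n,0⟩≤q) placed with n ≤? proj0 q
... | yes n≤m = n≤m
... | no  n≰m = contradiction (trans (sym α-q-true) α-q-false) λ ()
  where
  m r e : ℕ
  m = proj0 q
  r = proj1 q
  e = at 0 (t n) m
  ⟨m,r⟩≡q : pair m r ≡ q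
  ⟨m,r⟩≡q = pair-unpair q
  n≤m+r : n ≤ m + r
  n≤m+r = pair-diagonal n m r (subst (pair n 0 ≤_) (sym ⟨m,r⟩≡q) ⟨n,0⟩≤q)
  e<r : e < r
  e<r = +-cancelˡ-< m e r (≤-trans (t-bound n m (≰⇒> n≰m)) n≤m+r)
  r>0 : 0 < r
  r>0 = ≤-trans (s≤s z≤n) e<r
  |s-e|<r : length (s e) < r
  |s-e|<r = subst (_< r) (sym (s-length e)) e<r
  α-at-q : α q ≡ ext10 (s e) r
  α-at-q = trans (cong α (sym ⟨m,r⟩≡q)) (hα m (≰⇒> n≰m) r)
  α-q-true : α q ≡ true
  α-q-true = placed-last α q placed r>0
  α-q-false : α q ≡ false
  α-q-false = trans α-at-q (ext10-beyond (s e) r |s-e|<r)
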